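{- For every agent $i$, the schema $U_i\bullet_i\phi\to U_i\phi$ is not valid: there is a formula $\phi$ of $\mathbf{LUT}$ with $\nvDash U_i\bullet_i\phi\to U_i\phi$.
   Context: Let $\mathbf{P}$ be a countably infinite set of propositional variables and $\mathbf{I}$ a finite set of agents. The language $\mathbf{LUT}$ is given by $\phi::= p\mid\neg\phi\mid(\phi\land\phi)\mid K_i\phi\mid[\phi]\phi\mid U_i\phi$ ($p\in\mathbf{P}$, $i\in\mathbf{I}$); $\mathbf{EL}$ is the fragment without $[\cdot]$ and $U_i$. The abbreviation $\bullet_i\phi$ stands for $\phi\land\neg K_i\phi$. A model is $\mathcal{M}=\langle S,\{R_i\}_{i\in\mathbf{I}},V\rangle$ with $S\neq\emptyset$, each $R_i$ a reflexive relation on $S$, $V:\mathbf{P}\to2^S$. Truth: $p$ true at $s$ iff $s\in V(p)$; Boolean clauses as usual; $\mathcal{M},s\vDash K_i\phi$ iff $\phi$ holds at all $t$ with $sR_it$; $\mathcal{M},s\vDash[\psi]\phi$ iff ($\mathcal{M},s\vDash\psi$ implies $\mathcal{M}|_\psi,s\vDash\phi$), with $\mathcal{M}|_\psi$ the restriction of $\mathcal{M}$ to the states where $\psi$ is true; $\mathcal{M},s\vDash U_i\phi$ iff $\mathcal{M},s\vDash\phi$ and for all $\psi\in\mathbf{EL}$, $\mathcal{M},s\vDash[\psi]\neg K_i\phi$. $\vDash\phi$ means $\phi$ is true at every state of every model. -}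

module Defs where

open import Data.Nat using (ℕ)
open import Data.Fin using (Fin)
open import Data.Product using (Σ; _×_; _,_; proj₁)
open import Data.Empty using (⊥)
open import Relation.Nullary using (¬_)

data Form (n : ℕ) : Set where
  var  : ℕ → Form n
  ¬'_  : Form n → Form n
  _∧'_ : Form n → Form n → Form n
  K    : Fin n → Form n → Form n
  [_]_ : Form n → Form n → Form n
  U    : Fin n → Form n → Form n

data ELForm (n : ℕ) : Set where
  var  : ℕ → ELForm n
  ¬'_  : ELForm n → ELForm n
  _∧'_ : ELForm n → ELForm n → ELForm n
  K    : Fin n → ELForm n → ELForm n

embed : ∀ {n} → ELForm n → Form n
embed (var p)  = var p
embed (¬' φ)   = ¬' embed φ
embed (φ ∧' ψ) = embed φ ∧' embed ψ
embed (K i φ)  = K i (embed φ)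

_⇒'_ : ∀ {n} → Form n → Form n → Form n
φ ⇒' ψ = ¬' (φ ∧' (¬' ψ))

• : ∀ {n} → Fin n → Form n → Form n
• i φ = φ ∧' (¬' K i φ)

record Model (n : ℕ) : Set₁ where
  field
    S    : Set
    R    : Fin n → S → S → Set
    refl : ∀ i s → R i s s
    V    : ℕ → S → Set
open Model public

satEL : ∀ {n} (M : Model n) → S M → ELForm n → Set
satEL M s (var p)  = V M p s
satEL M s (¬' φ)   = ¬ satEL M s φ
satEL M s (φ ∧' ψ) = satEL M s φ × satEL M s ψ
satEL M s (K i φ)  = ∀ t → R M i s t → satEL M t φ

restrictBy : ∀ {n} (M : Model n) → (S M → Set) → Model n
restrictBy M P = record
  { S    = Σ (S M) P
  ; R    = λ i s t → R M i (proj₁ s) (proj₁ t)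
  ; refl = λ i s → Model.refl M i (proj₁ s)
  ; V    = λ p s → V M p (proj₁ s)
  }

sat : ∀ {n} (M : Model n) → S M → Form n → Set
sat M s (var p)   = V M p s
sat M s (¬' φ)    = ¬ sat M s φ
sat M s (φ ∧' ψ)  = sat M s φ × sat M s ψ
sat M s (K i φ)   = ∀ t → R M i s t → sat M t φ
sat M s ([ ψ ] φ) = (h : sat M s ψ) → sat (restrictBy M (λ u → sat M u ψ)) (s , h) φ
  -- M,s ⊨ Uᵢφ  iff  M,s ⊨ φ and for all ψ ∈ EL, M,s ⊨ [ψ]¬Kᵢφ
  -- (the clause for [ψ]¬Kᵢφ is unfolded so that recursion is structural;
  --  truth of the EL formula ψ is computed by satEL, which agrees with sat ∘ embed)
sat M s (U i φ)   =
    sat M s φ ×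
    ((ψ : ELForm _) → (h : satEL M s ψ) →
       ¬ (∀ t → R (restrictBy M (λ u → satEL M u ψ)) i (s , h) t →
              sat (restrictBy M (λ u → satEL M u ψ)) t φ))

Valid : ∀ {n} → Form n → Set₁
Valid {n} φ = (M : Model n) (s : S M) → sat M s φ

{-# OPTIONS --safe #-}
module Submission where

open import Defs
open import Data.Nat using (ℕ)
open import Data.Fin using (Fin)
open import Data.Product using (Σ; _,_; proj₁; proj₂)
open import Data.Bool using (Bool; true; false)
open import Data.Unit using (⊤; tt)
open import Relation.Nullary using (¬_)
open import Relation.Binary.PropositionalEquality using (_≡_) renaming (refl to ≡-refl)

-- In reflexive models nobody can know a Moore sentence, so [ψ]¬Kᵢ•ᵢφ holds
-- trivially and Uᵢ•ᵢφ collapses to •ᵢφ. On the other hand Uᵢp is never true: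
-- announcing p itself makes p known. A state where p holds but is not known
-- therefore refutes Uᵢ•ᵢp → Uᵢp.

¬K• : ∀ {n} (M : Model n) (s : S M) (i : Fin n) (φ : Form n) →
      ¬ sat M s (K i (• i φ))
¬K• M s i φ k = proj₂ (k s (Model.refl M i s)) (λ t r → proj₁ (k t r))

•⇒U• : ∀ {n} (M : Model n) (s : S M) (i : Fin n) (φ : Form n) →
       sat M s (• i φ) → sat M s (U i (• i φ))
•⇒U• M s i φ bullet = bullet , λ ψ h → ¬K• (restrictBy M (λ u → satEL M u ψ)) (s , h) i φ

¬U-var : ∀ {n} (M : Model n) (s : S M) (i : Fin n) (p : ℕ) → ¬ sat M s (U i (var p))
¬U-var M s i p (holds , unknowable) = unknowable (var p) holds (λ t _ → proj₂ t)

universalBool : (n : ℕ) → Model n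
universalBool n = record
  { S = Bool ; R = λ _ _ _ → ⊤ ; refl = λ _ _ → tt ; V = λ _ s → s ≡ true }

•-var-universalBool : (n : ℕ) (i : Fin n) (p : ℕ) → sat (universalBool n) true (• i (var p))
•-var-universalBool n i p = ≡-refl , λ k → false≢true (k false tt)
  where
    false≢true : ¬ false ≡ true
    false≢true ()

mainTheorem12 : (n : ℕ) (i : Fin n) → Σ (Form n) (λ φ → ¬ Valid (U i (• i φ) ⇒' U i φ))
mainTheorem12 n i = var 0 , λ valid → valid M true (U•p , ¬U-var M true i 0)
  where
    M : Model n
    M = universalBool n
    U•p : sat M true (U i (• i (var 0)))
    U•p = •⇒U• M true i (var 0) (•-var-universalBool n i 0)
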